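{- Let $I\subseteq\mathbb{Z}^+$ be finite nonempty with $m=\max(I)$, and let $a(I,x)=\sum_{k=0}^m a_k(I)x^k$ and $\overline{a}(I,x)=\sum_{k=0}^{m-1}\overline{a}_k(I)x^k$. Then $a(I,x)=x\,\overline{a}(I,x+1)$.
   Context: For a finite set $I\subseteq\mathbb{Z}^+$ let $m=\max(I\cup\{0\})$; for integers $n>m$, $d(I,n)$ is the number of permutations $\pi$ of $[n]$ with descent set $\{i\in[n-1]:\pi_i>\pi_{i+1}\}=I$, and $d(I,n)$ also denotes the unique degree-$m$ polynomial in $n$ agreeing with this count for all $n>m$. Binomial: $\binom{w}{k}=w(w-1)\cdots(w-k+1)/k!$. The coefficients $a_k(I)$ are defined by $d(I,n)=\sum_{k=0}^m a_k(I)\binom{n-m}{k}$, and the coefficients $\overline{a}_k(I)$, $-1\le k\le m-1$, by $d(I,n)=\sum_{k=-1}^{m-1}\overline{a}_k(I)\binom{n-m+k}{k+1}$. -}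

module Defs where

open import Data.Bool using (Bool; true; false; _∧_; not; if_then_else_)
open import Data.Bool.ListAction using (any; all)
open import Data.Nat using (ℕ; zero; suc; _≡ᵇ_; _<ᵇ_; _⊔_)
open import Data.List using (List; []; _∷_; map; concatMap; filter; length; foldr; upTo)
open import Data.Integer using (ℤ; _+_) renaming (+_ to ⁺_)
open import Relation.Nullary.Decidable using (Dec; yes; no)
open import Data.Bool.Properties using () renaming (T? to T?)
open import Data.Bool using (T)

Σ< : ℕ → (ℕ → ℤ) → ℤ
Σ< zero    f = ⁺ 0
Σ< (suc n) f = Σ< n f + f n

-- Finite sets of positive integers are represented as lists (duplicates harmless).
elem : ℕ → List ℕ → Bool
elem x xs = any (x ≡ᵇ_) xs

maxL : List ℕ → ℕ
maxL = foldr _⊔_ 0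

words : ℕ → ℕ → List (List ℕ)
words zero    n = [] ∷ []
words (suc k) n = concatMap (λ w → map (_∷ w) (map suc (upTo n))) (words k n)

noDup : List ℕ → Bool
noDup []       = true
noDup (x ∷ xs) = not (elem x xs) ∧ noDup xs

-- Descent positions of a word w₁ w₂ … (1-indexed), given the index of the head.
descFrom : ℕ → List ℕ → List ℕ
descFrom i []             = []
descFrom i (x ∷ [])       = []
descFrom i (x ∷ y ∷ rest) =
  if y <ᵇ x then i ∷ descFrom (suc i) (y ∷ rest) else descFrom (suc i) (y ∷ rest)

descentSet : List ℕ → List ℕ
descentSet = descFrom 1

sameSet : List ℕ → List ℕ → Bool
sameSet A B = all (λ a → elem a B) A ∧ all (λ b → elem b A) B

-- A permutation of [n] (a length-n word over [n] with no repeats) has descent set I.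
hasDescentSet : List ℕ → List ℕ → Bool
hasDescentSet I π = noDup π ∧ sameSet (descentSet π) I

d : List ℕ → ℕ → ℕ
d I n = length (filter (λ π → T? (hasDescentSet I π)) (words n n))

module Submission where

-- Let m = max I.  For N ≥ 1 the hypotheses express d(I, m+N) in two ways,
--   P N = Σ_{k≤m} a_k C(N,k)   and   Q N = ā₋₁ + Σ_{k<m} ā_k C(N+k,k+1),
-- and both are polynomials of degree ≤ m in N (their (m+1)-st forward
-- differences vanish).  The count D N = d(I, m+N) itself is such a polynomial
-- for all N ≥ 0: inserting the largest letter n+1 into the permutations of [n]
-- yields the recurrence D(n+1) − D(n) = Σ_{p<m} (counts of the same kind for
-- statistics supported on {1,…,m−1}), and induction on m gives Δ^{m+1} = 0
-- from n = m on.  Polynomials of degree ≤ m agreeing at N ≥ 1 agree at 0, so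
-- P = Q = D; hence a₀ = D 0 = d(I,m) = 0, as no permutation of [m] has
-- the descent m ∈ I.  Iterated differences at 0 then give
-- a_{j+1} = Σ_k ā_k C(k,j), which the binomial theorem turns into the claim.

open import Defs
open import Data.Nat using (ℕ; suc; _<_; _∸_; _≤_; _+_)
open import Data.Nat.Combinatorics using (_C_)
open import Data.Integer using (ℤ; _*_; _^_; +_; 1ℤ) renaming (_+_ to _+ℤ_)
open import Data.List using (List; [])
open import Data.List.Relation.Unary.All using (All)
open import Relation.Binary.PropositionalEquality using (_≡_; _≢_)

open import Data.Nat using (zero; z≤n; s≤s; _≡ᵇ_; _<ᵇ_)
open import Data.Nat.Combinatorics using (nCk+nC[k+1]≡[n+1]C[k+1]; k>n⇒nCk≡0; nCk≡nC[n∸k])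
import Data.Nat.Properties as ℕP
open import Data.Integer using (0ℤ; _-_)
import Data.Integer.Properties as ℤP
open import Data.Integer.Solver using (module +-*-Solver)
open import Data.List using (_∷_; map; length; foldr; concat; _++_; filter; upTo; applyUpTo)
import Data.List.Properties as LP
open import Data.List.Relation.Unary.All using ([]; _∷_)
open import Data.Bool using (Bool; true; false; T; _∧_; _∨_; not; if_then_else_)
open import Data.Bool.ListAction using (all)
import Data.Bool.Properties as BP
open import Data.Fin using (Fin; toℕ)
open import Data.Unit using (⊤; tt)
open import Data.Empty using (⊥; ⊥-elim)
open import Data.Product using (_×_; _,_)
open import Data.Sum using (inj₁; inj₂)
open import Relation.Binary.Definitions using (tri<; tri≈; tri>)
open import Relation.Binary.PropositionalEquality using (refl; sym; trans; cong; cong₂; subst; module ≡-Reasoning)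
import Algebra.Properties.CommutativeSemiring.Binomial ℤP.+-*-commutativeSemiring as Binomial
import Algebra.Properties.Semiring.Exp ℤP.+-*-semiring as SemiringExp
import Algebra.Properties.Semiring.Mult ℤP.+-*-semiring as SemiringMult
open import Algebra.Properties.Monoid.Sum ℤP.+-0-monoid using (sum; sum-cong-≗)

open +-*-Solver
open ≡-Reasoning

Σ-cong : ∀ n {f g : ℕ → ℤ} → (∀ k → k < n → f k ≡ g k) → Σ< n f ≡ Σ< n g
Σ-cong zero    h = refl
Σ-cong (suc n) h = cong₂ _+ℤ_ (Σ-cong n (λ k k<n → h k (ℕP.m<n⇒m<1+n k<n))) (h n ℕP.≤-refl)

Σ-zero : ∀ n {f : ℕ → ℤ} → (∀ k → k < n → f k ≡ 0ℤ) → Σ< n f ≡ 0ℤ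
Σ-zero zero    h = refl
Σ-zero (suc n) h = cong₂ _+ℤ_ (Σ-zero n (λ k k<n → h k (ℕP.m<n⇒m<1+n k<n))) (h n ℕP.≤-refl)

Σ-front : ∀ n (f : ℕ → ℤ) → Σ< (suc n) f ≡ f 0 +ℤ Σ< n (λ k → f (suc k))
Σ-front zero    f = trans (ℤP.+-identityˡ (f 0)) (sym (ℤP.+-identityʳ (f 0)))
Σ-front (suc n) f = trans (cong (_+ℤ f (suc n)) (Σ-front n f)) (ℤP.+-assoc (f 0) _ _)

Σ-+ : ∀ n (f g : ℕ → ℤ) → Σ< n (λ k → f k +ℤ g k) ≡ Σ< n f +ℤ Σ< n g
Σ-+ zero    f g = refl
Σ-+ (suc n) f g = trans (cong (_+ℤ (f n +ℤ g n)) (Σ-+ n f g))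
  (solve 4 (λ a b c d → (a :+ b) :+ (c :+ d) := (a :+ c) :+ (b :+ d)) refl (Σ< n f) (Σ< n g) (f n) (g n))

Σ-difference : ∀ n (f g : ℕ → ℤ) → Σ< n (λ k → f k - g k) ≡ Σ< n f - Σ< n g
Σ-difference zero    f g = refl
Σ-difference (suc n) f g = trans (cong (_+ℤ (f n - g n)) (Σ-difference n f g))
  (solve 4 (λ a b c d → (a :- b) :+ (c :- d) := (a :+ c) :- (b :+ d)) refl (Σ< n f) (Σ< n g) (f n) (g n))

Σ-*ˡ : ∀ n (c : ℤ) (f : ℕ → ℤ) → Σ< n (λ k → c * f k) ≡ c * Σ< n f
Σ-*ˡ zero    c f = sym (ℤP.*-zeroʳ c)
Σ-*ˡ (suc n) c f = trans (cong (_+ℤ c * f n) (Σ-*ˡ n c f)) (sym (ℤP.*-distribˡ-+ c (Σ< n f) (f n)))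

Σ-*ʳ : ∀ n (c : ℤ) (f : ℕ → ℤ) → Σ< n (λ k → f k * c) ≡ Σ< n f * c
Σ-*ʳ n c f = trans (Σ-cong n (λ k _ → ℤP.*-comm (f k) c)) (trans (Σ-*ˡ n c f) (ℤP.*-comm c _))

Σ-swap : ∀ n m (f : ℕ → ℕ → ℤ) → Σ< n (λ i → Σ< m (f i)) ≡ Σ< m (λ j → Σ< n (λ i → f i j))
Σ-swap zero    m f = sym (Σ-zero m (λ _ _ → refl))
Σ-swap (suc n) m f = trans (cong (_+ℤ Σ< m (f n)) (Σ-swap n m f)) (sym (Σ-+ m (λ j → Σ< n (λ i → f i j)) (f n)))

Σ-truncate : ∀ m n (f : ℕ → ℤ) → m ≤ n → (∀ k → m ≤ k → k < n → f k ≡ 0ℤ) → Σ< n f ≡ Σ< m f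
Σ-truncate m zero    f z≤n h = refl
Σ-truncate m (suc n) f m≤1+n h with ℕP.m≤n⇒m<n∨m≡n m≤1+n
... | inj₂ refl = refl
... | inj₁ m<1+n = trans (cong₂ _+ℤ_ (Σ-truncate m n f m≤n (λ k m≤k k<n → h k m≤k (ℕP.m<n⇒m<1+n k<n))) (h n m≤n ℕP.≤-refl))
                         (ℤP.+-identityʳ _)
  where
  m≤n : m ≤ n
  m≤n = ℕP.≤-pred m<1+n

Σ-single : ∀ n j (g : ℕ → ℤ) → j < n → (∀ k → k < n → k ≢ j → g k ≡ 0ℤ) → Σ< n g ≡ g j
Σ-single n j g j<n h = begin
  Σ< n g                               ≡⟨ Σ-truncate (suc j) n g j<n (λ k j<k k<n → h k k<n (λ { refl → ℕP.<-irrefl refl j<k })) ⟩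
  Σ< j g +ℤ g j                        ≡⟨ cong (_+ℤ g j) (Σ-zero j (λ k k<j → h k (ℕP.<-trans k<j j<n) (λ { refl → ℕP.<-irrefl refl k<j }))) ⟩
  0ℤ +ℤ g j                            ≡⟨ ℤP.+-identityˡ (g j) ⟩
  g j                                  ∎

Δ : (ℕ → ℤ) → ℕ → ℤ
Δ f n = f (suc n) - f n

iterΔ : ℕ → (ℕ → ℤ) → ℕ → ℤ
iterΔ zero    f = f
iterΔ (suc k) f = iterΔ k (Δ f)

iterΔ-cong : ∀ k (f g : ℕ → ℤ) N → (∀ n → N ≤ n → f n ≡ g n) → ∀ n → N ≤ n → iterΔ k f n ≡ iterΔ k g n
iterΔ-cong zero    f g N h n N≤n = h n N≤n
iterΔ-cong (suc k) f g N h n N≤n =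
  iterΔ-cong k (Δ f) (Δ g) N (λ n' N≤n' → cong₂ _-_ (h (suc n') (ℕP.m≤n⇒m≤1+n N≤n')) (h n' N≤n')) n N≤n

iterΔ-cong-≗ : ∀ k {f g : ℕ → ℤ} → (∀ n → f n ≡ g n) → ∀ n → iterΔ k f n ≡ iterΔ k g n
iterΔ-cong-≗ k {f} {g} h n = iterΔ-cong k f g 0 (λ n' _ → h n') n z≤n

iterΔ-Σ : ∀ k M (h : ℕ → ℕ → ℤ) n → iterΔ k (λ n → Σ< M (λ p → h p n)) n ≡ Σ< M (λ p → iterΔ k (h p) n)
iterΔ-Σ zero    M h n = refl
iterΔ-Σ (suc k) M h n =
  trans (iterΔ-cong-≗ k (λ n' → sym (Σ-difference M (λ p → h p (suc n')) (λ p → h p n'))) n) (iterΔ-Σ k M (λ p → Δ (h p)) n)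

iterΔ-scale : ∀ k (c : ℤ) (f : ℕ → ℤ) n → iterΔ k (λ n → c * f n) n ≡ c * iterΔ k f n
iterΔ-scale zero    c f n = refl
iterΔ-scale (suc k) c f n =
  trans (iterΔ-cong-≗ k (λ n' → solve 3 (λ c a b → c :* a :- c :* b := c :* (a :- b)) refl c (f (suc n')) (f n')) n)
        (iterΔ-scale k c (Δ f) n)

iterΔ-offset : ∀ k (c : ℤ) (f : ℕ → ℤ) n → iterΔ (suc k) (λ n → c +ℤ f n) n ≡ iterΔ (suc k) f n
iterΔ-offset k c f = iterΔ-cong-≗ k (λ n' → solve 3 (λ c a b → (c :+ a) :- (c :+ b) := a :- b) refl c (f (suc n')) (f n'))

iterΔ-shift : ∀ k (f : ℕ → ℤ) c n → iterΔ k (λ N → f (c + N)) n ≡ iterΔ k f (c + n)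
iterΔ-shift zero    f c n = refl
iterΔ-shift (suc k) f c n =
  trans (iterΔ-cong-≗ k (λ n' → cong (λ z → f z - f (c + n')) (ℕP.+-suc c n')) n) (iterΔ-shift k (Δ f) c n)

-- Pascal's rule as a difference equation: Δ C(N + c, r + 1) = C(N + c, r).
Δ-binomial : ∀ c r n → Δ (λ N → + ((N + c) C suc r)) n ≡ + ((n + c) C r)
Δ-binomial c r n = begin
  + ((suc n + c) C suc r) - + ((n + c) C suc r)                 ≡⟨ cong (λ z → + z - + ((n + c) C suc r)) (sym (nCk+nC[k+1]≡[n+1]C[k+1] (n + c) r)) ⟩
  + ((n + c) C r + (n + c) C suc r) - + ((n + c) C suc r)      ≡⟨ cong (_- + ((n + c) C suc r)) (ℤP.pos-+ ((n + c) C r) _) ⟩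
  (+ ((n + c) C r) +ℤ + ((n + c) C suc r)) - + ((n + c) C suc r) ≡⟨ solve 2 (λ a b → (a :+ b) :- b := a) refl (+ ((n + c) C r)) (+ ((n + c) C suc r)) ⟩
  + ((n + c) C r)                                                ∎

iterΔ-binomial-≤ : ∀ t r c n → t ≤ r → iterΔ t (λ N → + ((N + c) C r)) n ≡ + ((n + c) C (r ∸ t))
iterΔ-binomial-≤ zero    r       c n _         = refl
iterΔ-binomial-≤ (suc t) (suc r) c n (s≤s t≤r) =
  trans (iterΔ-cong-≗ t (Δ-binomial c r) n) (iterΔ-binomial-≤ t r c n t≤r)

iterΔ-binomial-> : ∀ t r c n → r < t → iterΔ t (λ N → + ((N + c) C r)) n ≡ 0ℤ
iterΔ-binomial-> (suc t) zero    c n _ = iterΔ-zero t n  -- Δ C(N + c, 0) = 1 - 1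
  where
  iterΔ-zero : ∀ t n → iterΔ t (λ _ → 0ℤ) n ≡ 0ℤ
  iterΔ-zero zero    n = refl
  iterΔ-zero (suc t) n = iterΔ-zero t n
iterΔ-binomial-> (suc t) (suc r) c n (s≤s r<t) =
  trans (iterΔ-cong-≗ t (Δ-binomial c r) n) (iterΔ-binomial-> t r c n r<t)

-- f is a polynomial of degree ≤ M in the sense of finite differences.
Degree≤ : ℕ → (ℕ → ℤ) → Set
Degree≤ M f = ∀ n → iterΔ (suc M) f n ≡ 0ℤ

agree-at-zero : ∀ k (f g : ℕ → ℤ) → (∀ N → f (suc N) ≡ g (suc N)) → iterΔ k f 0 ≡ iterΔ k g 0 → f 0 ≡ g 0
agree-at-zero zero    f g _   e = e
agree-at-zero (suc k) f g hyp e = begin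
  f 0               ≡⟨ solve 2 (λ a b → b := a :- (a :- b)) refl (f 1) (f 0) ⟩
  f 1 - Δ f 0       ≡⟨ cong₂ _-_ (hyp 0) Δf0≡Δg0 ⟩
  g 1 - Δ g 0       ≡⟨ solve 2 (λ a b → a :- (a :- b) := b) refl (g 1) (g 0) ⟩
  g 0               ∎
  where
  Δf0≡Δg0 : Δ f 0 ≡ Δ g 0
  Δf0≡Δg0 = agree-at-zero k (Δ f) (Δ g) (λ N → cong₂ _-_ (hyp (suc N)) (hyp N)) e

degree-extension : ∀ M {f g : ℕ → ℤ} → Degree≤ M f → Degree≤ M g → (∀ N → f (suc N) ≡ g (suc N)) → ∀ N → f N ≡ g N
degree-extension M {f} {g} df dg hyp zero    = agree-at-zero (suc M) f g hyp (trans (df 0) (sym (dg 0)))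
degree-extension M         df dg hyp (suc N) = hyp N

iterΔ-binomial-plain : ∀ j r n → iterΔ j (λ N → + (N C r)) n ≡ iterΔ j (λ N → + ((N + 0) C r)) n
iterΔ-binomial-plain j r = iterΔ-cong-≗ j (λ N → cong (λ z → + (z C r)) (sym (ℕP.+-identityʳ N)))

iterΔ-binomial-same : ∀ j → iterΔ j (λ N → + (N C j)) 0 ≡ 1ℤ
iterΔ-binomial-same j = begin
  iterΔ j (λ N → + (N C j)) 0        ≡⟨ iterΔ-binomial-plain j j 0 ⟩
  iterΔ j (λ N → + ((N + 0) C j)) 0  ≡⟨ iterΔ-binomial-≤ j j 0 0 ℕP.≤-refl ⟩
  + (0 C (j ∸ j))                    ≡⟨ cong (λ z → + (0 C z)) (ℕP.n∸n≡0 j) ⟩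
  1ℤ                                 ∎

iterΔ-binomial-other : ∀ j r → r ≢ j → iterΔ j (λ N → + (N C r)) 0 ≡ 0ℤ
iterΔ-binomial-other j r r≢j with ℕP.<-cmp r j
... | tri< r<j _ _ = trans (iterΔ-binomial-plain j r 0) (iterΔ-binomial-> j r 0 0 r<j)
... | tri≈ _ r≡j _ = ⊥-elim (r≢j r≡j)
... | tri> _ _ j<r = trans (iterΔ-binomial-plain j r 0)
                    (trans (iterΔ-binomial-≤ j r 0 0 (ℕP.<⇒≤ j<r)) (cong +_ (k>n⇒nCk≡0 (ℕP.m<n⇒0<n∸m j<r))))

binomialSum : (ℕ → ℤ) → ℕ → ℕ → ℤ
binomialSum c M N = Σ< M (λ k → c k * + (N C k))

binomialSum-degree : ∀ m c → Degree≤ m (binomialSum c (suc m))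
binomialSum-degree m c n = begin
  iterΔ (suc m) (binomialSum c (suc m)) n                   ≡⟨ iterΔ-Σ (suc m) (suc m) (λ k N → c k * + (N C k)) n ⟩
  Σ< (suc m) (λ k → iterΔ (suc m) (λ N → c k * + (N C k)) n) ≡⟨ Σ-zero (suc m) vanish ⟩
  0ℤ                                                        ∎
  where
  vanish : ∀ k → k < suc m → iterΔ (suc m) (λ N → c k * + (N C k)) n ≡ 0ℤ
  vanish k k<1+m = begin
    iterΔ (suc m) (λ N → c k * + (N C k)) n        ≡⟨ iterΔ-scale (suc m) (c k) _ n ⟩
    c k * iterΔ (suc m) (λ N → + (N C k)) n        ≡⟨ cong (c k *_) (iterΔ-cong-≗ (suc m) (λ N → cong (λ z → + (z C k)) (sym (ℕP.+-identityʳ N))) n) ⟩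
    c k * iterΔ (suc m) (λ N → + ((N + 0) C k)) n  ≡⟨ cong (c k *_) (iterΔ-binomial-> (suc m) k 0 n k<1+m) ⟩
    c k * 0ℤ                                       ≡⟨ ℤP.*-zeroʳ (c k) ⟩
    0ℤ                                             ∎

binomialSum-coefficient : ∀ c M j → j < M → iterΔ j (binomialSum c M) 0 ≡ c j
binomialSum-coefficient c M j j<M = begin
  iterΔ j (binomialSum c M) 0                     ≡⟨ iterΔ-Σ j M (λ k N → c k * + (N C k)) 0 ⟩
  Σ< M (λ k → iterΔ j (λ N → c k * + (N C k)) 0)  ≡⟨ Σ-cong M (λ k _ → iterΔ-scale j (c k) _ 0) ⟩
  Σ< M (λ k → c k * iterΔ j (λ N → + (N C k)) 0)  ≡⟨ Σ-single M j _ j<M (λ k _ k≢j → trans (cong (c k *_) (iterΔ-binomial-other j k k≢j)) (ℤP.*-zeroʳ (c k))) ⟩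
  c j * iterΔ j (λ N → + (N C j)) 0               ≡⟨ cong (c j *_) (iterΔ-binomial-same j) ⟩
  c j * 1ℤ                                        ≡⟨ ℤP.*-identityʳ (c j) ⟩
  c j                                             ∎

risingSum : ℤ → (ℕ → ℤ) → ℕ → ℕ → ℤ
risingSum c₀ c M N = c₀ +ℤ Σ< M (λ k → c k * + ((N + k) C suc k))

risingSum-iterΔ : ∀ t c₀ c M n → iterΔ (suc t) (risingSum c₀ c M) n ≡ Σ< M (λ k → c k * iterΔ (suc t) (λ N → + ((N + k) C suc k)) n)
risingSum-iterΔ t c₀ c M n = begin
  iterΔ (suc t) (risingSum c₀ c M) n                                        ≡⟨ iterΔ-offset t c₀ _ n ⟩
  iterΔ (suc t) (λ N → Σ< M (λ k → c k * + ((N + k) C suc k))) n           ≡⟨ iterΔ-Σ (suc t) M (λ k N → c k * + ((N + k) C suc k)) n ⟩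
  Σ< M (λ k → iterΔ (suc t) (λ N → c k * + ((N + k) C suc k)) n)           ≡⟨ Σ-cong M (λ k _ → iterΔ-scale (suc t) (c k) _ n) ⟩
  Σ< M (λ k → c k * iterΔ (suc t) (λ N → + ((N + k) C suc k)) n)           ∎

risingSum-degree : ∀ c₀ c m → Degree≤ m (risingSum c₀ c m)
risingSum-degree c₀ c m n = trans (risingSum-iterΔ m c₀ c m n)
  (Σ-zero m (λ k k<m → trans (cong (c k *_) (iterΔ-binomial-> (suc m) (suc k) k n (s≤s k<m))) (ℤP.*-zeroʳ (c k))))

iterΔ-rising-at-0 : ∀ j k → iterΔ (suc j) (λ N → + ((N + k) C suc k)) 0 ≡ + (k C j)
iterΔ-rising-at-0 j k with ℕP.≤-<-connex j k
... | inj₁ j≤k = trans (iterΔ-binomial-≤ (suc j) (suc k) k 0 (s≤s j≤k)) (cong +_ (sym (nCk≡nC[n∸k] j≤k)))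
... | inj₂ k<j = trans (iterΔ-binomial-> (suc j) (suc k) k 0 (s≤s k<j)) (cong +_ (sym (k>n⇒nCk≡0 k<j)))

risingSum-coefficient : ∀ c₀ c M j → iterΔ (suc j) (risingSum c₀ c M) 0 ≡ Σ< M (λ k → c k * + (k C j))
risingSum-coefficient c₀ c M j = trans (risingSum-iterΔ j c₀ c M 0) (Σ-cong M (λ k _ → cong (c k *_) (iterΔ-rising-at-0 j k)))

-- The library's binomial theorem is phrased with semiring powers, ℕ-multiples
-- and sums over Fin; these agree with ℤ's _^_, _*_ and Σ<.
^-semiring : ∀ x n → x SemiringExp.^ n ≡ x ^ n
^-semiring x zero    = refl
^-semiring x (suc n) = cong (x *_) (^-semiring x n)

×-semiring : ∀ n x → n SemiringMult.× x ≡ + n * x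
×-semiring zero    x = refl
×-semiring (suc n) x = trans (cong (x +ℤ_) (×-semiring n x)) (sym (ℤP.suc-* (+ n) x))

sum-Σ< : ∀ n (f : ℕ → ℤ) → sum (λ (i : Fin n) → f (toℕ i)) ≡ Σ< n f
sum-Σ< zero    f = refl
sum-Σ< (suc n) f = trans (cong (f 0 +ℤ_) (sum-Σ< n (λ k → f (suc k)))) (sym (Σ-front n f))

binomial-theorem : ∀ x k B → k < B → (x +ℤ 1ℤ) ^ k ≡ Σ< B (λ j → + (k C j) * x ^ j)
binomial-theorem x k B k<B = begin
  (x +ℤ 1ℤ) ^ k                                ≡⟨ sym (^-semiring (x +ℤ 1ℤ) k) ⟩
  (x +ℤ 1ℤ) SemiringExp.^ k                    ≡⟨ Binomial.theorem k x 1ℤ ⟩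
  Binomial.binomialExpansion x 1ℤ k            ≡⟨ sum-cong-≗ {suc k} (λ i → term (toℕ i)) ⟩
  sum (λ (i : Fin (suc k)) → term′ (toℕ i))    ≡⟨ sum-Σ< (suc k) term′ ⟩
  Σ< (suc k) term′                             ≡⟨ sym (Σ-truncate (suc k) B term′ k<B (λ j k<j _ → cong (λ z → + z * x ^ j) (k>n⇒nCk≡0 k<j))) ⟩
  Σ< B term′                                   ∎
  where
  term′ : ℕ → ℤ
  term′ j = + (k C j) * x ^ j
  term : ∀ j → (k C j) SemiringMult.× (x SemiringExp.^ j * 1ℤ SemiringExp.^ (k ∸ j)) ≡ term′ j
  term j = begin
    (k C j) SemiringMult.× (x SemiringExp.^ j * 1ℤ SemiringExp.^ (k ∸ j)) ≡⟨ ×-semiring (k C j) _ ⟩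
    + (k C j) * (x SemiringExp.^ j * 1ℤ SemiringExp.^ (k ∸ j))            ≡⟨ cong₂ (λ a b → + (k C j) * (a * b)) (^-semiring x j) (trans (^-semiring 1ℤ (k ∸ j)) (ℤP.^-zeroˡ (k ∸ j))) ⟩
    + (k C j) * (x ^ j * 1ℤ)                                               ≡⟨ cong (+ (k C j) *_) (ℤP.*-identityʳ (x ^ j)) ⟩
    + (k C j) * x ^ j                                                      ∎

shifted-series : ∀ m (a ab : ℕ → ℤ) x → a 0 ≡ 0ℤ → (∀ j → j < m → a (suc j) ≡ Σ< m (λ k → ab k * + (k C j))) →
  Σ< (suc m) (λ k → a k * x ^ k) ≡ x * Σ< m (λ k → ab k * (x +ℤ 1ℤ) ^ k)
shifted-series m a ab x a₀≡0 coeff = begin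
  Σ< (suc m) (λ k → a k * x ^ k)                                      ≡⟨ Σ-front m (λ k → a k * x ^ k) ⟩
  a 0 * 1ℤ +ℤ Σ< m (λ j → a (suc j) * (x * x ^ j))                    ≡⟨ cong₂ _+ℤ_ (cong (_* 1ℤ) a₀≡0) (Σ-cong m (λ j j<m → cong (_* (x * x ^ j)) (coeff j j<m))) ⟩
  0ℤ +ℤ Σ< m (λ j → Σ< m (λ k → ab k * + (k C j)) * (x * x ^ j))      ≡⟨ ℤP.+-identityˡ _ ⟩
  Σ< m (λ j → Σ< m (λ k → ab k * + (k C j)) * (x * x ^ j))            ≡⟨ Σ-cong m (λ j _ → sym (Σ-*ʳ m (x * x ^ j) (λ k → ab k * + (k C j)))) ⟩
  Σ< m (λ j → Σ< m (λ k → ab k * + (k C j) * (x * x ^ j)))            ≡⟨ sym (Σ-swap m m (λ k j → ab k * + (k C j) * (x * x ^ j))) ⟩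
  Σ< m (λ k → Σ< m (λ j → ab k * + (k C j) * (x * x ^ j)))            ≡⟨ Σ-cong m (λ k k<m → expand k k<m) ⟩
  Σ< m (λ k → x * (ab k * (x +ℤ 1ℤ) ^ k))                             ≡⟨ Σ-*ˡ m x _ ⟩
  x * Σ< m (λ k → ab k * (x +ℤ 1ℤ) ^ k)                               ∎
  where
  expand : ∀ k → k < m → Σ< m (λ j → ab k * + (k C j) * (x * x ^ j)) ≡ x * (ab k * (x +ℤ 1ℤ) ^ k)
  expand k k<m = begin
    Σ< m (λ j → ab k * + (k C j) * (x * x ^ j))   ≡⟨ Σ-cong m (λ j _ → solve 4 (λ b c y z → b :* c :* (y :* z) := y :* b :* (c :* z)) refl (ab k) (+ (k C j)) x (x ^ j)) ⟩
    Σ< m (λ j → x * ab k * (+ (k C j) * x ^ j))   ≡⟨ Σ-*ˡ m (x * ab k) _ ⟩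
    x * ab k * Σ< m (λ j → + (k C j) * x ^ j)     ≡⟨ cong (x * ab k *_) (sym (binomial-theorem x k m k<m)) ⟩
    x * ab k * (x +ℤ 1ℤ) ^ k                      ≡⟨ ℤP.*-assoc x (ab k) _ ⟩
    x * (ab k * (x +ℤ 1ℤ) ^ k)                    ∎

letterSum : ℕ → (ℕ → ℤ) → ℤ
letterSum n g = Σ< n (λ i → g (suc i))

wordSum : ℕ → ℕ → (List ℕ → ℤ) → ℤ
wordSum zero    n F = F []
wordSum (suc k) n F = wordSum k n (λ w → letterSum n (λ x → F (x ∷ w)))

IsWord : ℕ → ℕ → List ℕ → Set
IsWord zero    n []      = ⊤
IsWord zero    n (_ ∷ _) = ⊥
IsWord (suc k) n []      = ⊥
IsWord (suc k) n (x ∷ w) = (0 < x × x ≤ n) × IsWord k n w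

wordSum-cong : ∀ k n (F G : List ℕ → ℤ) → (∀ w → IsWord k n w → F w ≡ G w) → wordSum k n F ≡ wordSum k n G
wordSum-cong zero    n F G h = h [] tt
wordSum-cong (suc k) n F G h =
  wordSum-cong k n _ _ (λ w w-ok → Σ-cong n (λ i i<n → h (suc i ∷ w) ((s≤s z≤n , i<n) , w-ok)))

wordSum-zero : ∀ k n (F : List ℕ → ℤ) → (∀ w → IsWord k n w → F w ≡ 0ℤ) → wordSum k n F ≡ 0ℤ
wordSum-zero zero    n F h = h [] tt
wordSum-zero (suc k) n F h =
  wordSum-zero k n _ (λ w w-ok → Σ-zero n (λ i i<n → h (suc i ∷ w) ((s≤s z≤n , i<n) , w-ok)))

wordSum-+ : ∀ k n (F G : List ℕ → ℤ) → wordSum k n (λ w → F w +ℤ G w) ≡ wordSum k n F +ℤ wordSum k n G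
wordSum-+ zero    n F G = refl
wordSum-+ (suc k) n F G =
  trans (wordSum-cong k n _ _ (λ w _ → Σ-+ n (λ i → F (suc i ∷ w)) (λ i → G (suc i ∷ w)))) (wordSum-+ k n _ _)

isWord-length : ∀ k n w → IsWord k n w → length w ≡ k
isWord-length zero    n []      _          = refl
isWord-length (suc k) n (x ∷ w) (_ , w-ok) = cong suc (isWord-length k n w w-ok)

listSum : List ℤ → ℤ
listSum = foldr _+ℤ_ 0ℤ

listSum-++ : ∀ xs ys → listSum (xs ++ ys) ≡ listSum xs +ℤ listSum ys
listSum-++ []       ys = sym (ℤP.+-identityˡ _)
listSum-++ (x ∷ xs) ys = trans (cong (x +ℤ_) (listSum-++ xs ys)) (sym (ℤP.+-assoc x _ _))

listSum-concat : ∀ {A : Set} (F : A → ℤ) (xss : List (List A)) →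
  listSum (map F (concat xss)) ≡ listSum (map (λ xs → listSum (map F xs)) xss)
listSum-concat F []         = refl
listSum-concat F (xs ∷ xss) = begin
  listSum (map F (xs ++ concat xss))                 ≡⟨ cong listSum (LP.map-++ F xs (concat xss)) ⟩
  listSum (map F xs ++ map F (concat xss))           ≡⟨ listSum-++ (map F xs) _ ⟩
  listSum (map F xs) +ℤ listSum (map F (concat xss)) ≡⟨ cong (listSum (map F xs) +ℤ_) (listSum-concat F xss) ⟩
  listSum (map F xs) +ℤ listSum (map (λ ys → listSum (map F ys)) xss) ∎

listSum-applyUpTo : ∀ (g : ℕ → ℤ) (f : ℕ → ℕ) n → listSum (map g (applyUpTo f n)) ≡ Σ< n (λ i → g (f i))
listSum-applyUpTo g f zero    = refl
listSum-applyUpTo g f (suc n) =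
  trans (cong (g (f 0) +ℤ_) (listSum-applyUpTo g (λ i → f (suc i)) n)) (sym (Σ-front n (λ i → g (f i))))

listSum-letters : ∀ n (g : ℕ → ℤ) → listSum (map g (map suc (upTo n))) ≡ letterSum n g
listSum-letters n g = trans (cong listSum (sym (LP.map-∘ (upTo n)))) (listSum-applyUpTo (λ i → g (suc i)) (λ i → i) n)

listSum-words : ∀ k n (F : List ℕ → ℤ) → listSum (map F (words k n)) ≡ wordSum k n F
listSum-words zero    n F = ℤP.+-identityʳ (F [])
listSum-words (suc k) n F = begin
  listSum (map F (concat (map extend (words k n))))                     ≡⟨ listSum-concat F (map extend (words k n)) ⟩
  listSum (map (λ xs → listSum (map F xs)) (map extend (words k n)))   ≡⟨ cong listSum (sym (LP.map-∘ (words k n))) ⟩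
  listSum (map (λ w → listSum (map F (extend w))) (words k n))         ≡⟨ cong listSum (LP.map-cong extend-sum (words k n)) ⟩
  listSum (map (λ w → letterSum n (λ x → F (x ∷ w))) (words k n))      ≡⟨ listSum-words k n _ ⟩
  wordSum (suc k) n F                                                   ∎
  where
  extend : List ℕ → List (List ℕ)
  extend w = map (_∷ w) (map suc (upTo n))
  extend-sum : ∀ w → listSum (map F (extend w)) ≡ letterSum n (λ x → F (x ∷ w))
  extend-sum w = trans (cong listSum (sym (LP.map-∘ (map suc (upTo n))))) (listSum-letters n (λ x → F (x ∷ w)))

indicator : Bool → ℤ
indicator b = if b then 1ℤ else 0ℤ

count-as-listSum : ∀ {A : Set} (g : A → Bool) xs →
  + length (filter (λ π → BP.T? (g π)) xs) ≡ listSum (map (λ π → indicator (g π)) xs)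
count-as-listSum g []       = refl
count-as-listSum g (x ∷ xs) with g x
... | true  = cong (1ℤ +ℤ_) (count-as-listSum g xs)
... | false = trans (count-as-listSum g xs) (sym (ℤP.+-identityˡ _))

toTrue : ∀ {b} → T b → b ≡ true
toTrue {true} _ = refl

fromTrue : ∀ {b} → b ≡ true → T b
fromTrue refl = tt

≡ᵇ-refl : ∀ n → (n ≡ᵇ n) ≡ true
≡ᵇ-refl n = toTrue (ℕP.≡⇒≡ᵇ n n refl)

≡ᵇ-sound : ∀ m n → (m ≡ᵇ n) ≡ true → m ≡ n
≡ᵇ-sound m n e = ℕP.≡ᵇ⇒≡ m n (fromTrue e)

≡ᵇ-false : ∀ m n → m ≢ n → (m ≡ᵇ n) ≡ false
≡ᵇ-false m n m≢n with m ≡ᵇ n in e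
... | true  = ⊥-elim (m≢n (≡ᵇ-sound m n e))
... | false = refl

≡ᵇ-sym : ∀ m n → (m ≡ᵇ n) ≡ (n ≡ᵇ m)
≡ᵇ-sym zero    zero    = refl
≡ᵇ-sym zero    (suc n) = refl
≡ᵇ-sym (suc m) zero    = refl
≡ᵇ-sym (suc m) (suc n) = ≡ᵇ-sym m n

<ᵇ-true : ∀ m n → m < n → (m <ᵇ n) ≡ true
<ᵇ-true m n m<n = toTrue (ℕP.<⇒<ᵇ m<n)

<ᵇ-false : ∀ m n → n ≤ m → (m <ᵇ n) ≡ false
<ᵇ-false m n n≤m with m <ᵇ n in e
... | true  = ⊥-elim (ℕP.<⇒≱ (ℕP.<ᵇ⇒< m n (fromTrue e)) n≤m)
... | false = refl

∨-true : ∀ a {b} → b ≡ true → (a ∨ b) ≡ true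
∨-true a refl = BP.∨-zeroʳ a

elem-max : ∀ D j → maxL D < j → elem j D ≡ false
elem-max []      j _     = refl
elem-max (x ∷ D) j max<j = cong₂ _∨_ (≡ᵇ-false j x (λ { refl → ℕP.<-irrefl refl (ℕP.≤-<-trans (ℕP.m≤m⊔n j (maxL D)) max<j) }))
                                     (elem-max D j (ℕP.≤-<-trans (ℕP.m≤n⊔m x (maxL D)) max<j))

elem-below : ∀ b u → All (λ x → x < b) u → elem b u ≡ false
elem-below b []      []           = refl
elem-below b (x ∷ u) (x<b ∷ u<b) = cong₂ _∨_ (≡ᵇ-false b x (λ { refl → ℕP.<-irrefl refl x<b })) (elem-below b u u<b)

-- Inserting the letter b at position p of a word (at the end if p is too large).

insert : ℕ → ℕ → List ℕ → List ℕ
insert zero    b u       = b ∷ u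
insert (suc p) b []      = b ∷ []
insert (suc p) b (x ∷ u) = x ∷ insert p b u

elem-insert : ∀ p b u y → elem y (insert p b u) ≡ ((y ≡ᵇ b) ∨ elem y u)
elem-insert zero    b u       y = refl
elem-insert (suc p) b []      y = refl
elem-insert (suc p) b (x ∷ u) y = begin
  (y ≡ᵇ x) ∨ elem y (insert p b u)     ≡⟨ cong ((y ≡ᵇ x) ∨_) (elem-insert p b u y) ⟩
  (y ≡ᵇ x) ∨ ((y ≡ᵇ b) ∨ elem y u)     ≡⟨ sym (BP.∨-assoc (y ≡ᵇ x) _ _) ⟩
  ((y ≡ᵇ x) ∨ (y ≡ᵇ b)) ∨ elem y u     ≡⟨ cong (_∨ elem y u) (BP.∨-comm (y ≡ᵇ x) (y ≡ᵇ b)) ⟩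
  ((y ≡ᵇ b) ∨ (y ≡ᵇ x)) ∨ elem y u     ≡⟨ BP.∨-assoc (y ≡ᵇ b) _ _ ⟩
  (y ≡ᵇ b) ∨ ((y ≡ᵇ x) ∨ elem y u)     ∎

elem-insert-self : ∀ p b u → elem b (insert p b u) ≡ true
elem-insert-self p b u = trans (elem-insert p b u b) (cong (_∨ elem b u) (≡ᵇ-refl b))

noDup-insert-repeated : ∀ p b u → noDup u ≡ false → noDup (insert p b u) ≡ false
noDup-insert-repeated zero    b u       e = trans (cong (not (elem b u) ∧_) e) (BP.∧-zeroʳ _)
noDup-insert-repeated (suc p) b (x ∷ u) e with elem x u in x∈u
... | true  = cong (λ z → not z ∧ noDup (insert p b u)) (trans (elem-insert p b u x) (∨-true (x ≡ᵇ b) x∈u))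
... | false = trans (cong (not (elem x (insert p b u)) ∧_) (noDup-insert-repeated p b u e)) (BP.∧-zeroʳ _)

noDup-insert-fresh : ∀ p b u → elem b u ≡ false → noDup (insert p b u) ≡ noDup u
noDup-insert-fresh zero    b u       b∉u = cong (λ z → not z ∧ noDup u) b∉u
noDup-insert-fresh (suc p) b []      b∉u = refl
noDup-insert-fresh (suc p) b (x ∷ u) b∉u = cong₂ (λ z w → not z ∧ w)
  (trans (elem-insert p b u x) (cong (_∨ elem x u) (trans (≡ᵇ-sym x b) (BP.∨-conicalˡ (b ≡ᵇ x) _ b∉u))))
  (noDup-insert-fresh p b u (BP.∨-conicalʳ (b ≡ᵇ x) _ b∉u))

VanishesOnRepeats : (List ℕ → ℤ) → Set
VanishesOnRepeats F = ∀ w → noDup w ≡ false → F w ≡ 0ℤ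

-- Splitting by the position of the largest letter n+1: a repetition-free
-- word of length k+1 over [n+1] either avoids n+1, or arises uniquely by
-- inserting n+1 at a position p ≤ k into a word of length k over [n].
wordSum-insertMax : ∀ n k (F : List ℕ → ℤ) → VanishesOnRepeats F →
  wordSum (suc k) (suc n) F ≡ wordSum (suc k) n F +ℤ Σ< (suc k) (λ p → wordSum k n (λ u → F (insert p (suc n) u)))
wordSum-insertMax n zero    F F-rep = cong (letterSum n (λ x → F (x ∷ [])) +ℤ_) (sym (ℤP.+-identityˡ _))
wordSum-insertMax n (suc k) F F-rep = begin
  wordSum (suc k) (suc n) F′
    ≡⟨ wordSum-insertMax n k F′ F′-rep ⟩
  wordSum (suc k) n F′ +ℤ Σ< (suc k) (λ p → wordSum k n (λ u → F′ (insert p (suc n) u)))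
    ≡⟨ cong₂ _+ℤ_ (wordSum-+ (suc k) n (λ w → letterSum n (λ x → F (x ∷ w))) (λ w → F (suc n ∷ w))) (Σ-cong (suc k) (λ p _ → wordSum-cong k n _ _ (λ u _ → max-twice p u))) ⟩
  (wordSum (suc (suc k)) n F +ℤ wordSum (suc k) n (λ w → F (suc n ∷ w))) +ℤ Σ< (suc k) (λ p → wordSum (suc k) n (λ u → F (insert (suc p) (suc n) u)))
    ≡⟨ ℤP.+-assoc (wordSum (suc (suc k)) n F) _ _ ⟩
  wordSum (suc (suc k)) n F +ℤ (wordSum (suc k) n (λ w → F (suc n ∷ w)) +ℤ Σ< (suc k) (λ p → wordSum (suc k) n (λ u → F (insert (suc p) (suc n) u))))
    ≡⟨ cong (wordSum (suc (suc k)) n F +ℤ_) (sym (Σ-front (suc k) (λ p → wordSum (suc k) n (λ u → F (insert p (suc n) u))))) ⟩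
  wordSum (suc (suc k)) n F +ℤ Σ< (suc (suc k)) (λ p → wordSum (suc k) n (λ u → F (insert p (suc n) u)))
    ∎
  where
  F′ : List ℕ → ℤ
  F′ w = letterSum (suc n) (λ x → F (x ∷ w))
  F′-rep : VanishesOnRepeats F′
  F′-rep w e = Σ-zero (suc n) (λ i _ → F-rep (suc i ∷ w) (trans (cong (not (elem (suc i) w) ∧_) e) (BP.∧-zeroʳ _)))
  -- After n+1 has been inserted, prepending n+1 again creates a repetition.
  max-twice : ∀ p u → F′ (insert p (suc n) u) ≡ letterSum n (λ x → F (x ∷ insert p (suc n) u))
  max-twice p u = trans (cong (letterSum n (λ x → F (x ∷ insert p (suc n) u)) +ℤ_)
                              (F-rep _ (cong (λ z → not z ∧ noDup (insert p (suc n) u)) (elem-insert-self p (suc n) u))))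
                        (ℤP.+-identityʳ _)

wordSum-pigeonhole : ∀ n k (F : List ℕ → ℤ) → VanishesOnRepeats F → n < k → wordSum k n F ≡ 0ℤ
wordSum-pigeonhole zero    (suc k) F F-rep _ = wordSum-zero k zero _ (λ w _ → refl)
wordSum-pigeonhole (suc n) (suc k) F F-rep (s≤s n<k) = begin
  wordSum (suc k) (suc n) F
    ≡⟨ wordSum-insertMax n k F F-rep ⟩
  wordSum (suc k) n F +ℤ Σ< (suc k) (λ p → wordSum k n (λ u → F (insert p (suc n) u)))
    ≡⟨ cong₂ _+ℤ_ (wordSum-pigeonhole n (suc k) F F-rep (ℕP.m<n⇒m<1+n n<k))
                  (Σ-zero (suc k) (λ p _ → wordSum-pigeonhole n k _ (λ w e → F-rep _ (noDup-insert-repeated p (suc n) w e)) n<k)) ⟩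
  0ℤ
    ∎

-- Descents of a word, position by position: descAt w t holds iff
-- w_{t+1} > w_{t+2} (1-indexed), i.e. iff t+1 is a descent of w.

descAt : List ℕ → ℕ → Bool
descAt []          t       = false
descAt (x ∷ r)     (suc t) = descAt r t
descAt (x ∷ [])    zero    = false
descAt (x ∷ y ∷ r) zero    = y <ᵇ x

elem-ifCons-at : ∀ (c : Bool) i R → elem i R ≡ false → elem i (if c then i ∷ R else R) ≡ c
elem-ifCons-at true  i R _   = cong (_∨ elem i R) (≡ᵇ-refl i)
elem-ifCons-at false i R i∉R = i∉R

elem-ifCons-other : ∀ (c : Bool) i j R → (j ≡ᵇ i) ≡ false → elem j (if c then i ∷ R else R) ≡ elem j R
elem-ifCons-other true  i j R j≢i = cong (_∨ elem j R) j≢i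
elem-ifCons-other false i j R _   = refl

elem-descFrom-below : ∀ i j w → j < i → elem j (descFrom i w) ≡ false
elem-descFrom-below i j []          _   = refl
elem-descFrom-below i j (x ∷ [])    _   = refl
elem-descFrom-below i j (x ∷ y ∷ r) j<i =
  trans (elem-ifCons-other (y <ᵇ x) i j _ (≡ᵇ-false j i (λ { refl → ℕP.<-irrefl refl j<i })))
        (elem-descFrom-below (suc i) j (y ∷ r) (ℕP.m<n⇒m<1+n j<i))

elem-descFrom : ∀ t i w → elem (t + i) (descFrom i w) ≡ descAt w t
elem-descFrom t       i []          = refl
elem-descFrom zero    i (x ∷ [])    = refl
elem-descFrom (suc t) i (x ∷ [])    = refl
elem-descFrom zero    i (x ∷ y ∷ r) = elem-ifCons-at (y <ᵇ x) i _ (elem-descFrom-below (suc i) i (y ∷ r) ℕP.≤-refl)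
elem-descFrom (suc t) i (x ∷ y ∷ r) = begin
  elem (suc t + i) (if y <ᵇ x then i ∷ R else R) ≡⟨ elem-ifCons-other (y <ᵇ x) i (suc t + i) R (≡ᵇ-false (suc t + i) i 1+t+i≢i) ⟩
  elem (suc t + i) R                             ≡⟨ cong (λ z → elem z R) (sym (ℕP.+-suc t i)) ⟩
  elem (t + suc i) R                             ≡⟨ elem-descFrom t (suc i) (y ∷ r) ⟩
  descAt (x ∷ y ∷ r) (suc t)                     ∎
  where
  R : List ℕ
  R = descFrom (suc i) (y ∷ r)
  1+t+i≢i : suc t + i ≢ i
  1+t+i≢i e = ℕP.<-irrefl (sym e) (ℕP.m<n+m i (s≤s z≤n))

elem-descentSet-zero : ∀ w → elem 0 (descentSet w) ≡ false
elem-descentSet-zero w = elem-descFrom-below 1 0 w (s≤s z≤n)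

elem-descentSet-suc : ∀ w t → elem (suc t) (descentSet w) ≡ descAt w t
elem-descentSet-suc w t = trans (cong (λ z → elem z (descentSet w)) (ℕP.+-comm 1 t)) (elem-descFrom t 1 w)

descAt-beyond : ∀ u t → length u ≤ suc t → descAt u t ≡ false
descAt-beyond []          t       _           = refl
descAt-beyond (x ∷ [])    zero    _           = refl
descAt-beyond (x ∷ y ∷ r) zero    (s≤s ())
descAt-beyond (x ∷ r)     (suc t) (s≤s ℓ≤1+t) = descAt-beyond r t ℓ≤1+t

-- The descent pattern after inserting a letter larger than all others at
-- position p of a word with descent pattern μ: positions t < p-1 keep μ t,
-- position p-1 becomes an ascent, position p is a descent iff the new letter
-- has a successor (flag c), and positions t > p carry μ (t-1).
afterInsert : Bool → ℕ → (ℕ → Bool) → ℕ → Bool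
afterInsert c zero          μ zero    = c
afterInsert c zero          μ (suc t) = μ t
afterInsert c (suc p)       μ (suc t) = afterInsert c p (λ s → μ (suc s)) t
afterInsert c (suc zero)    μ zero    = false
afterInsert c (suc (suc p)) μ zero    = μ zero

afterInsert-cong : ∀ c p μ μ′ t → (∀ s → μ s ≡ μ′ s) → afterInsert c p μ t ≡ afterInsert c p μ′ t
afterInsert-cong c zero          μ μ′ zero    h = refl
afterInsert-cong c zero          μ μ′ (suc t) h = h t
afterInsert-cong c (suc zero)    μ μ′ zero    h = refl
afterInsert-cong c (suc (suc p)) μ μ′ zero    h = h 0
afterInsert-cong c (suc p)       μ μ′ (suc t) h = afterInsert-cong c p _ _ t (λ s → h (suc s))

afterInsert-at : ∀ c p μ → afterInsert c p μ p ≡ c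
afterInsert-at c zero    μ = refl
afterInsert-at c (suc p) μ = afterInsert-at c p _

afterInsert-above : ∀ c p μ s → p ≤ s → afterInsert c p μ (suc s) ≡ μ s
afterInsert-above c zero    μ s       _       = refl
afterInsert-above c (suc p) μ (suc s) (s≤s p≤s) = afterInsert-above c p _ s p≤s

afterInsert-end : ∀ p μ t → (∀ s → p ≤ suc s → μ s ≡ false) → afterInsert false p μ t ≡ μ t
afterInsert-end zero          μ zero    h = sym (h 0 z≤n)
afterInsert-end zero          μ (suc t) h = trans (h t z≤n) (sym (h (suc t) z≤n))
afterInsert-end (suc zero)    μ zero    h = sym (h 0 ℕP.≤-refl)
afterInsert-end (suc (suc p)) μ zero    h = refl
afterInsert-end (suc p)       μ (suc t) h = afterInsert-end p _ t (λ s p≤1+s → h (suc s) (s≤s p≤1+s))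

afterInsert-bound : ∀ c p μ t K → (∀ s → K ≤ s → μ s ≡ false) → afterInsert c p μ t ≡ true → t ≤ K + p
afterInsert-bound c zero    μ zero    K h e = z≤n
afterInsert-bound c zero    μ (suc t) K h e with ℕP.<-≤-connex t K
... | inj₁ t<K = subst (suc t ≤_) (sym (ℕP.+-identityʳ K)) t<K
... | inj₂ K≤t = ⊥-elim (BP.not-¬ e (h t K≤t))
afterInsert-bound c (suc p) μ zero    K h e = z≤n
afterInsert-bound c (suc p) μ (suc t) K h e =
  subst (suc t ≤_) (sym (ℕP.+-suc K p)) (s≤s (afterInsert-bound c p _ t K (λ s K≤s → h (suc s) (ℕP.m≤n⇒m≤1+n K≤s)) e))

descAt-insert : ∀ b p u t → All (λ x → x < b) u → p ≤ length u →
  descAt (insert p b u) t ≡ afterInsert (p <ᵇ length u) p (descAt u) t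
descAt-insert b zero          []          zero    _             _         = refl
descAt-insert b zero          (y ∷ u)     zero    (y<b ∷ _)     _         = <ᵇ-true y b y<b
descAt-insert b zero          u           (suc t) _             _         = refl
descAt-insert b (suc zero)    (x ∷ u)     zero    (x<b ∷ _)     _         = <ᵇ-false b x (ℕP.<⇒≤ x<b)
descAt-insert b (suc (suc p)) (x ∷ [])    zero    _             (s≤s ())
descAt-insert b (suc (suc p)) (x ∷ y ∷ u) zero    _             _         = refl
descAt-insert b (suc p)       (x ∷ u)     (suc t) (_ ∷ u<b)     (s≤s p≤ℓ) = descAt-insert b p u t u<b p≤ℓ

listBelow : ℕ → (ℕ → Bool) → List ℕ
listBelow zero    f = []
listBelow (suc B) f = if f B then B ∷ listBelow B f else listBelow B f

elem-listBelow-false : ∀ B f j → f j ≡ false → elem j (listBelow B f) ≡ false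
elem-listBelow-false zero    f j _  = refl
elem-listBelow-false (suc B) f j fj with f B in fB
... | true  = cong₂ _∨_ (≡ᵇ-false j B (λ { refl → BP.not-¬ fB fj })) (elem-listBelow-false B f j fj)
... | false = elem-listBelow-false B f j fj

elem-listBelow-true : ∀ B f j → f j ≡ true → j < B → elem j (listBelow B f) ≡ true
elem-listBelow-true (suc B) f j fj j<1+B with f B in fB | ℕP.m≤n⇒m<n∨m≡n (ℕP.≤-pred j<1+B)
... | true  | inj₂ refl = cong (_∨ elem j (listBelow j f)) (≡ᵇ-refl j)
... | true  | inj₁ j<B  = ∨-true (j ≡ᵇ B) (elem-listBelow-true B f j fj j<B)
... | false | inj₁ j<B  = elem-listBelow-true B f j fj j<B
... | false | inj₂ refl = ⊥-elim (BP.not-¬ fj fB)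

elem-listBelow : ∀ B f → (∀ j → f j ≡ true → j < B) → ∀ j → elem j (listBelow B f) ≡ f j
elem-listBelow B f bound j with f j in fj
... | true  = elem-listBelow-true B f j fj (bound j fj)
... | false = elem-listBelow-false B f j fj

-- The descent set of a permutation π after inserting its new maximum at a
-- position p < |π| that is followed by a letter, computed from D = Des π.
insertedPattern : ℕ → List ℕ → ℕ → Bool
insertedPattern p D zero    = false
insertedPattern p D (suc t) = afterInsert true p (λ s → elem (suc s) D) t

insertedDescentSet : ℕ → List ℕ → List ℕ
insertedDescentSet p D = listBelow (suc (suc (maxL D + p))) (insertedPattern p D)

elem-insertedDescentSet : ∀ p D j → elem j (insertedDescentSet p D) ≡ insertedPattern p D j
elem-insertedDescentSet p D = elem-listBelow _ _ bound
  where
  bound : ∀ j → insertedPattern p D j ≡ true → j < suc (suc (maxL D + p))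
  bound (suc t) e = s≤s (s≤s (afterInsert-bound true p _ t (maxL D) (λ s max≤s → elem-max D (suc s) (s≤s max≤s)) e))

SetInvariant : (List ℕ → ℤ) → Set
SetInvariant Q = ∀ D D′ → (∀ j → elem j D ≡ elem j D′) → Q D ≡ Q D′

SupportedUpTo : ℕ → (List ℕ → ℤ) → Set
SupportedUpTo m Q = ∀ D j → m < j → elem j D ≡ true → Q D ≡ 0ℤ

onPermutations : (List ℕ → ℤ) → List ℕ → ℤ
onPermutations Q w = if noDup w then Q (descentSet w) else 0ℤ

descentSum : (List ℕ → ℤ) → ℕ → ℤ
descentSum Q n = wordSum n n (onPermutations Q)

onPermutations-repeats : ∀ Q → VanishesOnRepeats (onPermutations Q)
onPermutations-repeats Q w e = cong (λ z → if z then Q (descentSet w) else 0ℤ) e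

isWord-letters : ∀ k n u → IsWord k n u → All (λ x → x < suc n) u
isWord-letters zero    n []      _                  = []
isWord-letters (suc k) n (x ∷ u) ((_ , x≤n) , u-ok) = s≤s x≤n ∷ isWord-letters k n u u-ok

-- Inserting n+1 into a word u over [n] preserves (non)repetition, so the
-- value on the inserted word is governed by u being a permutation.
onPermutations-insert : ∀ Q (R : List ℕ → ℤ) p n u → IsWord n n u →
  (noDup u ≡ true → Q (descentSet (insert p (suc n) u)) ≡ R u) →
  onPermutations Q (insert p (suc n) u) ≡ (if noDup u then R u else 0ℤ)
onPermutations-insert Q R p n u u-ok h
  rewrite noDup-insert-fresh p (suc n) u (elem-below (suc n) u (isWord-letters n n u u-ok)) with noDup u
... | true  = h refl
... | false = refl

descentSet-insert : ∀ n u p t → IsWord n n u → p ≤ n →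
  elem (suc t) (descentSet (insert p (suc n) u)) ≡ afterInsert (p <ᵇ n) p (descAt u) t
descentSet-insert n u p t u-ok p≤n = begin
  elem (suc t) (descentSet (insert p (suc n) u))           ≡⟨ elem-descentSet-suc (insert p (suc n) u) t ⟩
  descAt (insert p (suc n) u) t                            ≡⟨ descAt-insert (suc n) p u t (isWord-letters n n u u-ok) (subst (p ≤_) (sym ℓ≡n) p≤n) ⟩
  afterInsert (p <ᵇ length u) p (descAt u) t               ≡⟨ cong (λ z → afterInsert (p <ᵇ z) p (descAt u) t) ℓ≡n ⟩
  afterInsert (p <ᵇ n) p (descAt u) t                      ∎
  where
  ℓ≡n : length u ≡ n
  ℓ≡n = isWord-length n n u u-ok

insert-inside : ∀ Q n p u → SetInvariant Q → p < n → IsWord n n u →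
  onPermutations Q (insert p (suc n) u) ≡ onPermutations (λ D → Q (insertedDescentSet p D)) u
insert-inside Q n p u Q-set p<n u-ok =
  onPermutations-insert Q (λ w → Q (insertedDescentSet p (descentSet w))) p n u u-ok
    (λ _ → Q-set _ _ same-members)
  where
  same-members : ∀ j → elem j (descentSet (insert p (suc n) u)) ≡ elem j (insertedDescentSet p (descentSet u))
  same-members zero    = trans (elem-descentSet-zero (insert p (suc n) u)) (sym (elem-insertedDescentSet p (descentSet u) zero))
  same-members (suc t) = begin
    elem (suc t) (descentSet (insert p (suc n) u))          ≡⟨ descentSet-insert n u p t u-ok (ℕP.<⇒≤ p<n) ⟩
    afterInsert (p <ᵇ n) p (descAt u) t                     ≡⟨ cong (λ z → afterInsert z p (descAt u) t) (<ᵇ-true p n p<n) ⟩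
    afterInsert true p (descAt u) t                         ≡⟨ afterInsert-cong true p _ _ t (λ s → sym (elem-descentSet-suc u s)) ⟩
    insertedPattern p (descentSet u) (suc t)                ≡⟨ sym (elem-insertedDescentSet p (descentSet u) (suc t)) ⟩
    elem (suc t) (insertedDescentSet p (descentSet u))      ∎

-- Inserting n+1 at m ≤ p < n creates the descent p+1 > m.
insert-high : ∀ Q m n p u → SupportedUpTo m Q → m ≤ p → p < n → IsWord n n u →
  onPermutations Q (insert p (suc n) u) ≡ 0ℤ
insert-high Q m n p u Q-supp m≤p p<n u-ok =
  trans (onPermutations-insert Q (λ _ → 0ℤ) p n u u-ok (λ _ → Q-supp _ (suc p) (s≤s m≤p) new-descent))
        (BP.if-eta (noDup u))
  where
  new-descent : elem (suc p) (descentSet (insert p (suc n) u)) ≡ true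
  new-descent = trans (descentSet-insert n u p p u-ok (ℕP.<⇒≤ p<n)) (trans (afterInsert-at _ p _) (<ᵇ-true p n p<n))

-- Appending n+1 at the end does not change the descent set.
insert-end : ∀ Q n u → SetInvariant Q → IsWord n n u → onPermutations Q (insert n (suc n) u) ≡ onPermutations Q u
insert-end Q n u Q-set u-ok =
  onPermutations-insert Q (λ w → Q (descentSet w)) n n u u-ok (λ _ → Q-set _ _ same-members)
  where
  same-members : ∀ j → elem j (descentSet (insert n (suc n) u)) ≡ elem j (descentSet u)
  same-members zero    = trans (elem-descentSet-zero (insert n (suc n) u)) (sym (elem-descentSet-zero u))
  same-members (suc t) = begin
    elem (suc t) (descentSet (insert n (suc n) u))   ≡⟨ descentSet-insert n u n t u-ok ℕP.≤-refl ⟩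
    afterInsert (n <ᵇ n) n (descAt u) t              ≡⟨ cong (λ z → afterInsert z n (descAt u) t) (<ᵇ-false n n ℕP.≤-refl) ⟩
    afterInsert false n (descAt u) t                 ≡⟨ afterInsert-end n _ t (λ s n≤1+s → descAt-beyond u s (subst (_≤ suc s) (sym (isWord-length n n u u-ok)) n≤1+s)) ⟩
    descAt u t                                       ≡⟨ sym (elem-descentSet-suc u t) ⟩
    elem (suc t) (descentSet u)                      ∎

descentSum-recurrence : ∀ Q m n → SetInvariant Q → SupportedUpTo m Q → m ≤ n →
  descentSum Q (suc n) ≡ descentSum Q n +ℤ Σ< m (λ p → descentSum (λ D → Q (insertedDescentSet p D)) n)
descentSum-recurrence Q m n Q-set Q-supp m≤n = begin
  wordSum (suc n) (suc n) F
    ≡⟨ wordSum-insertMax n n F F-rep ⟩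
  wordSum (suc n) n F +ℤ Σ< (suc n) inserted
    ≡⟨ cong (_+ℤ Σ< (suc n) inserted) (wordSum-pigeonhole n (suc n) F F-rep ℕP.≤-refl) ⟩
  0ℤ +ℤ Σ< (suc n) inserted
    ≡⟨ ℤP.+-identityˡ _ ⟩
  Σ< n inserted +ℤ inserted n
    ≡⟨ cong₂ _+ℤ_ (Σ-truncate m n inserted m≤n (λ p m≤p p<n → wordSum-zero n n _ (λ u u-ok → insert-high Q m n p u Q-supp m≤p p<n u-ok)))
                  (wordSum-cong n n _ _ (λ u u-ok → insert-end Q n u Q-set u-ok)) ⟩
  Σ< m inserted +ℤ descentSum Q n
    ≡⟨ cong (_+ℤ descentSum Q n) (Σ-cong m (λ p p<m → wordSum-cong n n _ _ (λ u u-ok → insert-inside Q n p u Q-set (ℕP.<-≤-trans p<m m≤n) u-ok))) ⟩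
  Σ< m (λ p → descentSum (λ D → Q (insertedDescentSet p D)) n) +ℤ descentSum Q n
    ≡⟨ ℤP.+-comm _ (descentSum Q n) ⟩
  descentSum Q n +ℤ Σ< m (λ p → descentSum (λ D → Q (insertedDescentSet p D)) n)
    ∎
  where
  F : List ℕ → ℤ
  F = onPermutations Q
  F-rep : VanishesOnRepeats F
  F-rep = onPermutations-repeats Q
  inserted : ℕ → ℤ
  inserted p = wordSum n n (λ u → F (insert p (suc n) u))

insertedDescentSet-setInvariant : ∀ Q p → SetInvariant Q → SetInvariant (λ D → Q (insertedDescentSet p D))
insertedDescentSet-setInvariant Q p Q-set D D′ same = Q-set _ _ λ j →
  trans (elem-insertedDescentSet p D j) (trans (patterns j) (sym (elem-insertedDescentSet p D′ j)))
  where
  patterns : ∀ j → insertedPattern p D j ≡ insertedPattern p D′ j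
  patterns zero    = refl
  patterns (suc t) = afterInsert-cong true p _ _ t (λ s → same (suc s))

insertedDescentSet-support : ∀ Q m p → SupportedUpTo (suc m) Q → p ≤ m → SupportedUpTo m (λ D → Q (insertedDescentSet p D))
insertedDescentSet-support Q m p Q-supp p≤m D (suc s) (s≤s m≤s) s+1∈D =
  Q-supp _ (suc (suc s)) (s≤s (s≤s m≤s))
    (trans (elem-insertedDescentSet p D (suc (suc s))) (trans (afterInsert-above true p _ s (ℕP.≤-trans p≤m m≤s)) s+1∈D))

descentSum-degree : ∀ m Q → SetInvariant Q → SupportedUpTo m Q → ∀ n → m ≤ n → iterΔ (suc m) (descentSum Q) n ≡ 0ℤ
descentSum-degree m Q Q-set Q-supp n m≤n = begin
  iterΔ m (Δ (descentSum Q)) n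
    ≡⟨ iterΔ-cong m _ _ m (λ n′ m≤n′ → difference n′ m≤n′) n m≤n ⟩
  iterΔ m (λ n′ → Σ< m (λ p → descentSum (Q′ p) n′)) n
    ≡⟨ iterΔ-Σ m m (λ p → descentSum (Q′ p)) n ⟩
  Σ< m (λ p → iterΔ m (descentSum (Q′ p)) n)
    ≡⟨ terms-vanish m Q-supp m≤n ⟩
  0ℤ
    ∎
  where
  Q′ : ℕ → List ℕ → ℤ
  Q′ p D = Q (insertedDescentSet p D)
  difference : ∀ n′ → m ≤ n′ → Δ (descentSum Q) n′ ≡ Σ< m (λ p → descentSum (Q′ p) n′)
  difference n′ m≤n′ = trans (cong (_- descentSum Q n′) (descentSum-recurrence Q m n′ Q-set Q-supp m≤n′))
                             (solve 2 (λ a s → (a :+ s) :- a := s) refl (descentSum Q n′) _)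
  -- Each Q′ p (p < m) is supported up to m − 1, so by induction its sum has
  -- vanishing m-th differences; the split on m exposes m − 1.
  terms-vanish : ∀ k → SupportedUpTo k Q → k ≤ n → Σ< k (λ p → iterΔ k (descentSum (Q′ p)) n) ≡ 0ℤ
  terms-vanish zero    _       _   = refl
  terms-vanish (suc k) Q-supp′ k<n = Σ-zero (suc k) (λ p p<1+k →
    descentSum-degree k (Q′ p) (insertedDescentSet-setInvariant Q p Q-set)
      (insertedDescentSet-support Q k p Q-supp′ (ℕP.≤-pred p<1+k)) n (ℕP.≤-trans (ℕP.n≤1+n k) k<n))

all-true⇒ : ∀ (p : ℕ → Bool) xs x → all p xs ≡ true → elem x xs ≡ true → p x ≡ true
all-true⇒ p (y ∷ ys) x all-p x∈ with x ≡ᵇ y in x≡y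
... | true  = subst (λ z → p z ≡ true) (sym (≡ᵇ-sound x y x≡y)) (BP.∧-conicalˡ _ _ all-p)
... | false = all-true⇒ p ys x (BP.∧-conicalʳ _ _ all-p) x∈

all-true⇐ : ∀ (p : ℕ → Bool) xs → (∀ x → elem x xs ≡ true → p x ≡ true) → all p xs ≡ true
all-true⇐ p []       h = refl
all-true⇐ p (y ∷ ys) h = cong₂ _∧_ (h y (cong (_∨ elem y ys) (≡ᵇ-refl y))) (all-true⇐ p ys (λ x x∈ → h x (∨-true (x ≡ᵇ y) x∈)))

all-false : ∀ (p : ℕ → Bool) xs x → elem x xs ≡ true → p x ≡ false → all p xs ≡ false
all-false p xs x x∈ px with all p xs in all-p
... | true  = ⊥-elim (BP.not-¬ (all-true⇒ p xs x all-p x∈) px)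
... | false = refl

all-members : ∀ (p : ℕ → Bool) xs ys → (∀ j → elem j xs ≡ elem j ys) → all p xs ≡ all p ys
all-members p xs ys same with all p ys in all-ys
... | true  = all-true⇐ p xs (λ x x∈ → all-true⇒ p ys x all-ys (trans (sym (same x)) x∈))
... | false with all p xs in all-xs
...   | true  = ⊥-elim (BP.not-¬ (all-true⇐ p ys (λ x x∈ → all-true⇒ p xs x all-xs (trans (same x) x∈))) all-ys)
...   | false = refl

all-cong : ∀ (p q : ℕ → Bool) xs → (∀ x → p x ≡ q x) → all p xs ≡ all q xs
all-cong p q xs h = cong (foldr _∧_ true) (LP.map-cong h xs)

setIndicator : List ℕ → List ℕ → ℤ
setIndicator I D = indicator (sameSet D I)

setIndicator-setInvariant : ∀ I → SetInvariant (setIndicator I)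
setIndicator-setInvariant I D D′ same = cong indicator
  (cong₂ _∧_ (all-members (λ a → elem a I) D D′ same) (all-cong (λ b → elem b D) (λ b → elem b D′) I same))

setIndicator-support : ∀ I → SupportedUpTo (maxL I) (setIndicator I)
setIndicator-support I D j max<j j∈D =
  cong (λ z → indicator (z ∧ all (λ b → elem b D) I)) (all-false (λ a → elem a I) D j j∈D (elem-max I j max<j))

d≡descentSum : ∀ I n → + d I n ≡ descentSum (setIndicator I) n
d≡descentSum I n = begin
  + d I n                                                     ≡⟨ count-as-listSum (hasDescentSet I) (words n n) ⟩
  listSum (map (λ π → indicator (hasDescentSet I π)) (words n n)) ≡⟨ listSum-words n n _ ⟩
  wordSum n n (λ π → indicator (hasDescentSet I π))           ≡⟨ wordSum-cong n n _ _ (λ w _ → same w) ⟩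
  descentSum (setIndicator I) n                                      ∎
  where
  same : ∀ w → indicator (hasDescentSet I w) ≡ onPermutations (setIndicator I) w
  same w with noDup w
  ... | true  = refl
  ... | false = refl

elem-maxL : ∀ x xs → elem (maxL (x ∷ xs)) (x ∷ xs) ≡ true
elem-maxL x []       = trans (cong (λ z → elem z (x ∷ [])) (ℕP.⊔-identityʳ x)) (cong (_∨ false) (≡ᵇ-refl x))
elem-maxL x (y ∷ ys) with ℕP.≤-total x (maxL (y ∷ ys))
... | inj₁ x≤M = trans (cong (λ z → elem z (x ∷ y ∷ ys)) (ℕP.m≤n⇒m⊔n≡n x≤M)) (∨-true (maxL (y ∷ ys) ≡ᵇ x) (elem-maxL y ys))
... | inj₂ M≤x = trans (cong (λ z → elem z (x ∷ y ∷ ys)) (ℕP.m≥n⇒m⊔n≡m M≤x)) (cong (_∨ elem x (y ∷ ys)) (≡ᵇ-refl x))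

not-descent-at-length : ∀ u m → length u ≡ m → elem m (descentSet u) ≡ false
not-descent-at-length u zero    _   = elem-descentSet-zero u
not-descent-at-length u (suc t) ℓ≡m = trans (elem-descentSet-suc u t) (descAt-beyond u t (subst (_≤ suc t) (sym ℓ≡m) ℕP.≤-refl))

-- d(I, max I) = 0: a permutation of [m] never has the descent m ∈ I.
descentSum-at-max : ∀ I → I ≢ [] → descentSum (setIndicator I) (maxL I) ≡ 0ℤ
descentSum-at-max []      I≢[] = ⊥-elim (I≢[] refl)
descentSum-at-max (x ∷ I) _    = wordSum-zero m m _ vanish
  where
  m : ℕ
  m = maxL (x ∷ I)
  vanish : ∀ u → IsWord m m u → onPermutations (setIndicator (x ∷ I)) u ≡ 0ℤ
  vanish u u-ok with noDup u
  ... | false = refl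
  ... | true  = cong indicator (trans (cong (all (λ a → elem a (x ∷ I)) (descentSet u) ∧_) m-missing) (BP.∧-zeroʳ _))
    where
    m-missing : all (λ b → elem b (descentSet u)) (x ∷ I) ≡ false
    m-missing = all-false _ (x ∷ I) m (elem-maxL x I) (not-descent-at-length u m (isWord-length m m u u-ok))

shifted-descentSum-degree : ∀ m Q → SetInvariant Q → SupportedUpTo m Q → Degree≤ m (λ N → descentSum Q (m + N))
shifted-descentSum-degree m Q Q-set Q-supp N =
  trans (iterΔ-shift (suc m) (descentSum Q) m N) (descentSum-degree m Q Q-set Q-supp (m + N) (ℕP.m≤m+n m N))

expansion-everywhere : ∀ I (f : ℕ → ℤ) → Degree≤ (maxL I) f → (∀ n → maxL I < n → + d I n ≡ f (n ∸ maxL I)) →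
  ∀ N → f N ≡ descentSum (setIndicator I) (maxL I + N)
expansion-everywhere I f f-degree expansion = degree-extension m f-degree
  (shifted-descentSum-degree m (setIndicator I) (setIndicator-setInvariant I) (setIndicator-support I)) above-m
  where
  m : ℕ
  m = maxL I
  above-m : ∀ N → f (suc N) ≡ descentSum (setIndicator I) (m + suc N)
  above-m N = begin
    f (suc N)                                ≡⟨ cong f (sym (ℕP.m+n∸m≡n m (suc N))) ⟩
    f (m + suc N ∸ m)                        ≡⟨ sym (expansion (m + suc N) (ℕP.m<m+n m (s≤s z≤n))) ⟩
    + d I (m + suc N)                        ≡⟨ d≡descentSum I (m + suc N) ⟩
    descentSum (setIndicator I) (m + suc N)  ∎

proposition4p3 : (I : List ℕ) → I ≢ [] → All (λ i → 1 ≤ i) I →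
    (a : ℕ → ℤ) → (ab₋₁ : ℤ) → (ab : ℕ → ℤ) →
    (∀ n → maxL I < n →
      + d I n ≡ Σ< (suc (maxL I)) (λ k → a k * + ((n ∸ maxL I) C k))) →
    (∀ n → maxL I < n →
      + d I n ≡ ab₋₁ +ℤ Σ< (maxL I) (λ k → ab k * + ((n ∸ maxL I + k) C (suc k)))) →
    ∀ (x : ℤ) →
      Σ< (suc (maxL I)) (λ k → a k * (x ^ k))
        ≡ x * Σ< (maxL I) (λ k → ab k * ((x +ℤ 1ℤ) ^ k))
proposition4p3 I I≢[] _ a ab₋₁ ab a-expansion ab-expansion x = shifted-series m a ab x a₀≡0 coefficients
  where
  m : ℕ
  m = maxL I
  P≡D : ∀ N → binomialSum a (suc m) N ≡ descentSum (setIndicator I) (m + N)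
  P≡D = expansion-everywhere I (binomialSum a (suc m)) (binomialSum-degree m a) a-expansion
  Q≡D : ∀ N → risingSum ab₋₁ ab m N ≡ descentSum (setIndicator I) (m + N)
  Q≡D = expansion-everywhere I (risingSum ab₋₁ ab m) (risingSum-degree ab₋₁ ab m) ab-expansion
  a₀≡0 : a 0 ≡ 0ℤ
  a₀≡0 = begin
    a 0                                   ≡⟨ sym (binomialSum-coefficient a (suc m) 0 (s≤s z≤n)) ⟩
    binomialSum a (suc m) 0               ≡⟨ P≡D 0 ⟩
    descentSum (setIndicator I) (m + 0)   ≡⟨ cong (descentSum (setIndicator I)) (ℕP.+-identityʳ m) ⟩
    descentSum (setIndicator I) m         ≡⟨ descentSum-at-max I I≢[] ⟩
    0ℤ                                    ∎
  coefficients : ∀ j → j < m → a (suc j) ≡ Σ< m (λ k → ab k * + (k C j))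
  coefficients j j<m = begin
    a (suc j)                                   ≡⟨ sym (binomialSum-coefficient a (suc m) (suc j) (s≤s j<m)) ⟩
    iterΔ (suc j) (binomialSum a (suc m)) 0     ≡⟨ iterΔ-cong-≗ (suc j) (λ N → trans (P≡D N) (sym (Q≡D N))) 0 ⟩
    iterΔ (suc j) (risingSum ab₋₁ ab m) 0       ≡⟨ risingSum-coefficient ab₋₁ ab m j ⟩
    Σ< m (λ k → ab k * + (k C j))               ∎
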